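{- Let $k$ be a positive integer, $G$ a finite simple graph and $u_1u_2$ an edge of $G$. Let $G'$ be the graph obtained from $G$ by merging $u_1$ and $u_2$ into one vertex $u$. If $G' - N[u]$ contains an induced path on $k$ vertices, then $H_R(G',k,u)$ implies $H_R(G,k,u_1)$.
   Context: Graphs are finite, simple and loopless. $N(v)$ is the neighbourhood and $N[v]=N(v)\cup\{v\}$; for a set $X$, $N[X]=\bigcup_{x\in X}N[x]$ and $N(X)=N[X]\setminus X$. $G - Y$ denotes the subgraph induced by $V(G)\setminus Y$. Merging two adjacent vertices $u_1,u_2$ means replacing them by a new vertex $u$ with $N(u) = N(\{u_1,u_2\})$. A $P_k$ is an induced path on $k$ vertices. Given an induced path $P$ in $G$, an extension of $P$ is an induced path $xPy$ in $G$ (adding a vertex $x$ adjacent to one endpoint and a vertex $y$ adjacent to the other, the result being an induced path). An induced path $P$ is failing if no induced cycle of $G$ contains $P$. A path is avoidable in $G$ if it is induced and has no failing extension in $G$. For a graph $G$, positive integer $k$ and vertex $u$, the property $H_R(G,k,u)$ holds if either $G - N[u]$ contains no $P_k$, or there is a $P_k$ with all vertices in $V(G)\setminus N[u]$ that is avoidable in $G$ (avoidability being with respect to the whole graph $G$). -}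

module Defs where

open import Data.Nat using (ℕ; zero; suc; _≤_)
open import Data.Fin using (Fin; toℕ)
open import Data.Fin.Properties using () renaming (_≟_ to _≟F_)
open import Data.List using (List; []; _∷_; _++_; length; lookup; [_])
open import Data.List.Relation.Unary.All using (All)
open import Data.Product using (Σ; ∃; _×_; _,_; proj₁; proj₂)
open import Data.Sum using (_⊎_; inj₁; inj₂)
open import Data.Empty using (⊥)
open import Relation.Nullary using (¬_; Dec; yes; no)
open import Relation.Nullary.Decidable using (_×-dec_; _⊎-dec_; ¬?)
open import Relation.Binary.PropositionalEquality using (_≡_; _≢_; refl; sym)
open import Function.Bundles using (_⇔_)

record Graph (V : Set) : Set₁ where
  field
    Adj    : V → V → Set
    adj?   : ∀ a b → Dec (Adj a b)
    adj-sym    : ∀ {a b} → Adj a b → Adj b a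
    adj-irrefl : ∀ {a} → ¬ Adj a a
open Graph public

module _ {V : Set} (G : Graph V) where

  InClosedNbhd : V → V → Set
  InClosedNbhd u v = v ≡ u ⊎ Adj G u v

  InducedPath : List V → Set
  InducedPath p =
    (∀ i j → lookup p i ≡ lookup p j → i ≡ j) ×
    (∀ i j → Adj G (lookup p i) (lookup p j) ⇔
             (toℕ j ≡ suc (toℕ i) ⊎ toℕ i ≡ suc (toℕ j)))

  CycConsec : (m : ℕ) → Fin m → Fin m → Set
  CycConsec m i j =
    toℕ j ≡ suc (toℕ i) ⊎ toℕ i ≡ suc (toℕ j) ⊎
    (toℕ i ≡ 0 × suc (toℕ j) ≡ m) ⊎ (toℕ j ≡ 0 × suc (toℕ i) ≡ m)

  InducedCycle : List V → Set
  InducedCycle c =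
    3 ≤ length c ×
    (∀ i j → lookup c i ≡ lookup c j → i ≡ j) ×
    (∀ i j → Adj G (lookup c i) (lookup c j) ⇔ CycConsec (length c) i j)

  -- an induced cycle contains the path P (as a subpath) iff, after rotating
  -- and possibly reversing it, its cyclic vertex sequence is P followed by Q
  ContainedInInducedCycle : List V → Set
  ContainedInInducedCycle p = ∃ λ q → InducedCycle (p ++ q)

  Failing : List V → Set
  Failing p = InducedPath p × ¬ ContainedInInducedCycle p

  Extension : List V → V → V → Set
  Extension p x y = InducedPath (x ∷ (p ++ [ y ]))

  Avoidable : List V → Set
  Avoidable p =
    InducedPath p × (∀ x y → Extension p x y → ¬ Failing (x ∷ (p ++ [ y ])))

  -- P_k all of whose vertices lie outside N[u] (= a P_k of G - N[u])
  PkOutside : ℕ → V → List V → Set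
  PkOutside k u p =
    InducedPath p × length p ≡ k × All (λ v → ¬ InClosedNbhd u v) p

  HR : ℕ → V → Set
  HR k u = (¬ ∃ λ p → PkOutside k u p) ⊎ (∃ λ p → PkOutside k u p × Avoidable p)

-- Vertices of the merged graph: vertices of G other than u₂; the vertex u₁
-- plays the role of the new vertex u.  (The inequality proof is
-- irrelevant, so vertices are equal iff their underlying vertices are.)

record MVertex {n : ℕ} (u₂ : Fin n) : Set where
  constructor mv
  field
    vtx : Fin n
    .ne : vtx ≢ u₂
open MVertex public

module _ {n : ℕ} (G : Graph (Fin n)) (u₁ u₂ : Fin n) where

  -- u adjacent to w iff w ∈ N({u₁,u₂}); other adjacencies as in G
  MAdj : MVertex u₂ → MVertex u₂ → Set
  MAdj a b = vtx a ≢ vtx b ×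
    (Adj G (vtx a) (vtx b) ⊎
     (vtx a ≡ u₁ × Adj G u₂ (vtx b)) ⊎
     (vtx b ≡ u₁ × Adj G u₂ (vtx a)))

  private
    ≢? : ∀ (x y : Fin n) → Dec (x ≢ y)
    ≢? x y = ¬? (x ≟F y)

    msym : ∀ {a b} → MAdj a b → MAdj b a
    msym (ne , inj₁ e) = (λ eq → ne (sym eq)) , inj₁ (adj-sym G e)
    msym (ne , inj₂ (inj₁ x)) = (λ eq → ne (sym eq)) , inj₂ (inj₂ x)
    msym (ne , inj₂ (inj₂ x)) = (λ eq → ne (sym eq)) , inj₂ (inj₁ x)

  merge : Graph (MVertex u₂)
  merge = record
    { Adj    = MAdj
    ; adj?   = λ a b → ≢? (vtx a) (vtx b) ×-dec
                 (adj? G (vtx a) (vtx b) ⊎-dec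
                  ((vtx a ≟F u₁ ×-dec adj? G u₂ (vtx b)) ⊎-dec
                   (vtx b ≟F u₁ ×-dec adj? G u₂ (vtx a))))
    ; adj-sym    = λ {a} {b} → msym {a} {b}
    ; adj-irrefl = λ { (ne , _) → ne refl }
    }

  mergedVertex : Adj G u₁ u₂ → MVertex u₂
  mergedVertex e = mv u₁ (λ { refl → adj-irrefl G {u₁} e })

-- By the P_k hypothesis, H_R(G′, k, u) provides an avoidable P_k
-- P′ of G′ - N[u].  Its vertices are neither u₁ nor adjacent to u₁ or u₂,
-- so G and G′ agree on them and P = P′ (read in G) is a P_k of G - N[u₁].
-- An extension xPy in G lifts to an extension x′P′y′ in G′ (x and y are
-- adjacent to vertices of P, hence differ from u₁, u₂), which avoidability
-- of P′ places on an induced cycle C′ of G′.  Rotating C′ to start at u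
-- (if it passes through u), the rest of C′ is an induced path of G whose
-- vertices adjacent to u₁ or u₂ are exactly its ends; it closes to an
-- induced cycle of G through u₁, u₂ or the edge u₁u₂, which contains xPy.

module Submission where

open import Defs
open import Level using (0ℓ)
open import Data.Nat using (ℕ; zero; suc; _≤_; _<_; z≤n; s≤s)
open import Data.Nat.Properties using (suc-injective; <-irrefl; ≤-trans)
open import Data.Fin using (Fin; zero; suc; toℕ; cast; fromℕ; inject₁)
open import Data.Fin.Properties using (toℕ-injective; toℕ-cast; toℕ<n; toℕ-fromℕ; toℕ-inject₁; _≟_) renaming (suc-injective to Fin-suc-injective)
open import Data.List using (List; []; _∷_; _++_; length; lookup; [_]; map)
open import Data.List.Properties using (length-map; length-++-comm; ++-assoc; ++-identityʳ; map-++)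
open import Data.List.Relation.Unary.All as All using (All; _∷_)
open import Data.List.Relation.Unary.All.Properties using (++⁺; ¬Any⇒All¬; map⁺)
open import Data.List.Relation.Unary.Any using (any?; index; here; there)
open import Data.List.Relation.Unary.Any.Properties using (lookup-index)
open import Data.List.Membership.Propositional using (_∈_; find)
open import Data.List.Membership.Propositional.Properties using (∈-lookup; ∈-map⁻; ∈-∃++)
open import Data.Product using (∃; _×_; _,_; proj₁; proj₂)
import Data.Empty.Irrelevant as Irrelevant
open import Data.Sum using (_⊎_; inj₁; inj₂) renaming (map to ⊎-map)
open import Data.Empty using (⊥-elim)
open import Relation.Nullary using (¬_; yes; no)
open import Relation.Binary.PropositionalEquality using (_≡_; _≢_; refl; sym; trans; cong; cong₂; subst)
open import Function.Bundles using (_⇔_; mk⇔; Equivalence)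
open import Function.Properties.Equivalence using (⇔-setoid) renaming (trans to ⇔-trans)
open import Function.Construct.Symmetry using (⇔-sym)
open import Function.Construct.Identity using (⇔-id)
open Equivalence using (to; from)
import Relation.Binary.Reasoning.Setoid as SetoidReasoning

module ⇔-Reasoning = SetoidReasoning (⇔-setoid 0ℓ)

≡⇒⇔ : ∀ {A B : Set} → A ≡ B → A ⇔ B
≡⇒⇔ {A} refl = ⇔-id A

resolveˡ : ∀ {A B : Set} → A ⊎ B → ¬ B → A
resolveˡ (inj₁ a) ¬b = a
resolveˡ (inj₂ b) ¬b = ⊥-elim (¬b b)

resolveʳ : ∀ {A B : Set} → A ⊎ B → ¬ A → B
resolveʳ (inj₁ a) ¬a = ⊥-elim (¬a a)
resolveʳ (inj₂ b) ¬a = b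

PathAdj : ℕ → ℕ → Set
PathAdj a b = b ≡ suc a ⊎ a ≡ suc b

-- positions a, b are consecutive on a cycle of length m (definitionally
-- `CycConsec m i j` at a = toℕ i, b = toℕ j)
CycAdj : ℕ → ℕ → ℕ → Set
CycAdj m a b = b ≡ suc a ⊎ a ≡ suc b ⊎ (a ≡ 0 × suc b ≡ m) ⊎ (b ≡ 0 × suc a ≡ m)

IsEnd : ℕ → ℕ → Set
IsEnd m a = a ≡ 0 ⊎ suc a ≡ m

pathAdj-suc : ∀ {a b} → PathAdj (suc a) (suc b) ⇔ PathAdj a b
pathAdj-suc = mk⇔ (⊎-map suc-injective suc-injective) (⊎-map (cong suc) (cong suc))

pathAdj-comm : ∀ {a b} → PathAdj a b ⇔ PathAdj b a
pathAdj-comm = mk⇔ swap swap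
  where
  swap : ∀ {a b} → PathAdj a b → PathAdj b a
  swap (inj₁ e) = inj₂ e
  swap (inj₂ e) = inj₁ e

pathAdj-zero : ∀ {b} → PathAdj 0 (suc b) ⇔ b ≡ 0
pathAdj-zero = mk⇔ (λ { (inj₁ e) → suc-injective e }) (λ { refl → inj₁ refl })

cycAdj-comm : ∀ {m a b} → CycAdj m a b ⇔ CycAdj m b a
cycAdj-comm = mk⇔ swap swap
  where
  swap : ∀ {m a b} → CycAdj m a b → CycAdj m b a
  swap (inj₁ e) = inj₂ (inj₁ e)
  swap (inj₂ (inj₁ e)) = inj₁ e
  swap (inj₂ (inj₂ (inj₁ e))) = inj₂ (inj₂ (inj₂ e))
  swap (inj₂ (inj₂ (inj₂ e))) = inj₂ (inj₂ (inj₁ e))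

cycAdj-suc : ∀ {m a b} → CycAdj m (suc a) (suc b) ⇔ PathAdj a b
cycAdj-suc = mk⇔ to′ (⊎-map (cong suc) (λ e → inj₁ (cong suc e)))
  where
  to′ : ∀ {m a b} → CycAdj m (suc a) (suc b) → PathAdj a b
  to′ (inj₁ e) = inj₁ (suc-injective e)
  to′ (inj₂ (inj₁ e)) = inj₂ (suc-injective e)
  to′ (inj₂ (inj₂ (inj₁ (() , _))))
  to′ (inj₂ (inj₂ (inj₂ (() , _))))

cycAdj-zero : ∀ {m b} → CycAdj (suc m) 0 (suc b) ⇔ IsEnd m b
cycAdj-zero = mk⇔ to′ from′
  where
  to′ : ∀ {m b} → CycAdj (suc m) 0 (suc b) → IsEnd m b
  to′ (inj₁ e) = inj₁ (suc-injective e)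
  to′ (inj₂ (inj₂ (inj₁ (_ , e)))) = inj₂ (suc-injective e)
  from′ : ∀ {m b} → IsEnd m b → CycAdj (suc m) 0 (suc b)
  from′ (inj₁ refl) = inj₁ refl
  from′ (inj₂ e) = inj₂ (inj₂ (inj₁ (refl , cong suc e)))

cycAdj-irrefl : ∀ {m} → 3 ≤ m → ¬ CycAdj m 0 0
cycAdj-irrefl (s≤s (s≤s (s≤s _))) (inj₂ (inj₂ (inj₁ (_ , ()))))
cycAdj-irrefl (s≤s (s≤s (s≤s _))) (inj₂ (inj₂ (inj₂ (_ , ()))))

-- Local characterisations of induced paths and cycles

module _ {V : Set} (G : Graph V) where

  open ⇔-Reasoning

  adj-comm : ∀ {a b} → Adj G a b ⇔ Adj G b a
  adj-comm = mk⇔ (adj-sym G) (adj-sym G)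

  Distinct : List V → Set
  Distinct L = ∀ i j → lookup L i ≡ lookup L j → i ≡ j

  Off : V → List V → Set
  Off w L = ∀ i → w ≢ lookup L i

  distinct-cons : ∀ {w L} → Off w L → Distinct L → Distinct (w ∷ L)
  distinct-cons off dist zero    zero    _ = refl
  distinct-cons off dist zero    (suc j) e = ⊥-elim (off j e)
  distinct-cons off dist (suc i) zero    e = ⊥-elim (off i (sym e))
  distinct-cons off dist (suc i) (suc j) e = cong suc (dist i j e)

  path-cons : ∀ {w P} → InducedPath G P → Off w P →
              (∀ i → Adj G w (lookup P i) ⇔ toℕ i ≡ 0) → InducedPath G (w ∷ P)
  path-cons {w} {P} (dist , adj) off w-adj = distinct-cons off dist , adj′
    where
    adj′ : ∀ i j → Adj G (lookup (w ∷ P) i) (lookup (w ∷ P) j) ⇔ PathAdj (toℕ i) (toℕ j)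
    adj′ zero    zero    = mk⇔ (λ a → ⊥-elim (adj-irrefl G a)) (λ { (inj₁ ()) ; (inj₂ ()) })
    adj′ zero    (suc j) = ⇔-trans (w-adj j) (⇔-sym pathAdj-zero)
    adj′ (suc i) zero    = begin
      Adj G (lookup P i) w             ≈⟨ adj-comm ⟩
      Adj G w (lookup P i)             ≈⟨ adj′ zero (suc i) ⟩
      PathAdj 0 (suc (toℕ i))          ≈⟨ pathAdj-comm ⟩
      PathAdj (suc (toℕ i)) 0          ∎
    adj′ (suc i) (suc j) = ⇔-trans (adj i j) (⇔-sym pathAdj-suc)

  Closes : V → List V → Set
  Closes w R = InducedPath G R × Off w R ×
               (∀ i → Adj G w (lookup R i) ⇔ IsEnd (length R) (toℕ i))

  cycle-close : ∀ {w R} → 2 ≤ length R → Closes w R → InducedCycle G (w ∷ R)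
  cycle-close {w} {R} len ((dist , adj) , off , w-adj) = s≤s len , distinct-cons off dist , adj′
    where
    adj′ : ∀ i j → Adj G (lookup (w ∷ R) i) (lookup (w ∷ R) j) ⇔
                   CycAdj (suc (length R)) (toℕ i) (toℕ j)
    adj′ zero    zero    = mk⇔ (λ a → ⊥-elim (adj-irrefl G a)) (λ c → ⊥-elim (cycAdj-irrefl (s≤s len) c))
    adj′ zero    (suc j) = ⇔-trans (w-adj j) (⇔-sym cycAdj-zero)
    adj′ (suc i) zero    = begin
      Adj G (lookup R i) w                    ≈⟨ adj-comm ⟩
      Adj G w (lookup R i)                    ≈⟨ adj′ zero (suc i) ⟩
      CycAdj (suc (length R)) 0 (suc (toℕ i)) ≈⟨ cycAdj-comm ⟩
      CycAdj (suc (length R)) (suc (toℕ i)) 0 ∎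
    adj′ (suc i) (suc j) = ⇔-trans (adj i j) (⇔-sym cycAdj-suc)

  cycle-open : ∀ {w R} → InducedCycle G (w ∷ R) → 2 ≤ length R × Closes w R
  cycle-open {w} {R} (s≤s len , dist , adj) =
    len , ((λ i j e → Fin-suc-injective (dist (suc i) (suc j) e)) , λ i j → ⇔-trans (adj (suc i) (suc j)) cycAdj-suc) ,
    off , λ i → ⇔-trans (adj zero (suc i)) cycAdj-zero
    where
    off : Off w R
    off i e with dist zero (suc i) e
    ... | ()

-- Transporting induced paths and cycles along a change of vertex names

record Relabelling {VA VB : Set} (GA : Graph VA) (GB : Graph VB) (A : List VA) (B : List VB) : Set where
  field
    ρ      : Fin (length B) → Fin (length A)
    ρ-toℕ  : ∀ i → toℕ (ρ i) ≡ toℕ i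
    ρ-eq   : ∀ i j → lookup B i ≡ lookup B j → lookup A (ρ i) ≡ lookup A (ρ j)
    ρ-adj  : ∀ i j → Adj GB (lookup B i) (lookup B j) ⇔ Adj GA (lookup A (ρ i)) (lookup A (ρ j))

module _ {VA VB : Set} {GA : Graph VA} {GB : Graph VB} {A : List VA} {B : List VB}
         (R : Relabelling GA GB A B) where
  open Relabelling R
  open ⇔-Reasoning

  relabel-distinct : Distinct GA A → Distinct GB B
  relabel-distinct dist i j e =
    toℕ-injective (trans (sym (ρ-toℕ i)) (trans (cong toℕ (dist (ρ i) (ρ j) (ρ-eq i j e))) (ρ-toℕ j)))

  relabel-path : InducedPath GA A → InducedPath GB B
  relabel-path (dist , adj) = relabel-distinct dist , λ i j → begin
    Adj GB (lookup B i) (lookup B j)             ≈⟨ ρ-adj i j ⟩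
    Adj GA (lookup A (ρ i)) (lookup A (ρ j))     ≈⟨ adj (ρ i) (ρ j) ⟩
    PathAdj (toℕ (ρ i)) (toℕ (ρ j))              ≡⟨ cong₂ PathAdj (ρ-toℕ i) (ρ-toℕ j) ⟩
    PathAdj (toℕ i) (toℕ j)                      ∎

  relabel-cycle : length A ≡ length B → InducedCycle GA A → InducedCycle GB B
  relabel-cycle len (three , dist , adj) = subst (3 ≤_) len three , relabel-distinct dist , λ i j → begin
    Adj GB (lookup B i) (lookup B j)             ≈⟨ ρ-adj i j ⟩
    Adj GA (lookup A (ρ i)) (lookup A (ρ j))     ≈⟨ adj (ρ i) (ρ j) ⟩
    CycAdj (length A) (toℕ (ρ i)) (toℕ (ρ j))    ≡⟨ cong₂ (CycAdj (length A)) (ρ-toℕ i) (ρ-toℕ j) ⟩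
    CycAdj (length A) (toℕ i) (toℕ j)            ≡⟨ cong (λ m → CycAdj m (toℕ i) (toℕ j)) len ⟩
    CycAdj (length B) (toℕ i) (toℕ j)            ∎

module _ {A B : Set} (f : A → B) where

  lookup-map : ∀ xs i → lookup (map f xs) i ≡ f (lookup xs (cast (length-map f xs) i))
  lookup-map (x ∷ xs) zero    = refl
  lookup-map (x ∷ xs) (suc i) = lookup-map xs i

  lookup-map⁻ : ∀ xs i → lookup (map f xs) (cast (sym (length-map f xs)) i) ≡ f (lookup xs i)
  lookup-map⁻ (x ∷ xs) zero    = refl
  lookup-map⁻ (x ∷ xs) (suc i) = lookup-map⁻ xs i

module _ {VA VB : Set} (GA : Graph VA) (GB : Graph VB) (f : VA → VB) (L : List VA)
         (f-inj : ∀ {a b} → a ∈ L → b ∈ L → f a ≡ f b → a ≡ b)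
         (f-adj : ∀ {a b} → a ∈ L → b ∈ L → Adj GB (f a) (f b) ⇔ Adj GA a b) where

  private
    ι : Fin (length (map f L)) → Fin (length L)
    ι = cast (length-map f L)

    ι⁻ : Fin (length L) → Fin (length (map f L))
    ι⁻ = cast (sym (length-map f L))

    forward : Relabelling GA GB L (map f L)
    forward = record
      { ρ     = ι
      ; ρ-toℕ = toℕ-cast _
      ; ρ-eq  = λ i j e → f-inj (∈-lookup (ι i)) (∈-lookup (ι j))
                  (trans (sym (lookup-map f L i)) (trans e (lookup-map f L j)))
      ; ρ-adj = λ i j → ⇔-trans (≡⇒⇔ (cong₂ (Adj GB) (lookup-map f L i) (lookup-map f L j)))
                  (f-adj (∈-lookup (ι i)) (∈-lookup (ι j)))
      }

    backward : Relabelling GB GA (map f L) L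
    backward = record
      { ρ     = ι⁻
      ; ρ-toℕ = toℕ-cast _
      ; ρ-eq  = λ i j e → trans (lookup-map⁻ f L i) (trans (cong f e) (sym (lookup-map⁻ f L j)))
      ; ρ-adj = λ i j → ⇔-trans (⇔-sym (f-adj (∈-lookup i) (∈-lookup j)))
                  (≡⇒⇔ (sym (cong₂ (Adj GB) (lookup-map⁻ f L i) (lookup-map⁻ f L j))))
      }

  map-path : InducedPath GA L ⇔ InducedPath GB (map f L)
  map-path = mk⇔ (relabel-path forward) (relabel-path backward)

  map-cycle : InducedCycle GA L → InducedCycle GB (map f L)
  map-cycle = relabel-cycle forward (sym (length-map f L))

-- Rotating an induced cycle

CycSucc : ℕ → ℕ → ℕ → Set
CycSucc m a b = (suc a ≡ m × b ≡ 0) ⊎ (suc a < m × b ≡ suc a)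

cycSucc-functional : ∀ {m a b b′} → CycSucc m a b → CycSucc m a b′ → b ≡ b′
cycSucc-functional (inj₁ (_ , refl)) (inj₁ (_ , refl)) = refl
cycSucc-functional (inj₁ (e , _))    (inj₂ (lt , _))   = ⊥-elim (<-irrefl e lt)
cycSucc-functional (inj₂ (lt , _))   (inj₁ (e , _))    = ⊥-elim (<-irrefl e lt)
cycSucc-functional (inj₂ (_ , refl)) (inj₂ (_ , refl)) = refl

cycSucc-injective : ∀ {m a a′ b} → CycSucc m a b → CycSucc m a′ b → a ≡ a′
cycSucc-injective (inj₁ (e , _))    (inj₁ (e′ , _))   = suc-injective (trans e (sym e′))
cycSucc-injective (inj₁ (_ , refl)) (inj₂ (_ , ()))
cycSucc-injective (inj₂ (_ , refl)) (inj₁ (_ , ()))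
cycSucc-injective (inj₂ (_ , e))    (inj₂ (_ , e′))   = suc-injective (trans (sym e) e′)

cycSucc-< : ∀ {m a b} → 0 < m → CycSucc m a b → b < m
cycSucc-< pos (inj₁ (_ , refl)) = pos
cycSucc-< pos (inj₂ (lt , refl)) = lt

cycAdj⇔cycSucc : ∀ {m a b} → a < m → b < m → CycAdj m a b ⇔ (CycSucc m a b ⊎ CycSucc m b a)
cycAdj⇔cycSucc a<m b<m = mk⇔ (to′ a<m b<m) from′
  where
  to′ : ∀ {m a b} → a < m → b < m → CycAdj m a b → CycSucc m a b ⊎ CycSucc m b a
  to′ a<m b<m (inj₁ refl)                    = inj₁ (inj₂ (b<m , refl))
  to′ a<m b<m (inj₂ (inj₁ refl))             = inj₂ (inj₂ (a<m , refl))
  to′ a<m b<m (inj₂ (inj₂ (inj₁ (refl , e)))) = inj₂ (inj₁ (e , refl))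
  to′ a<m b<m (inj₂ (inj₂ (inj₂ (refl , e)))) = inj₁ (inj₁ (e , refl))
  from′ : ∀ {m a b} → CycSucc m a b ⊎ CycSucc m b a → CycAdj m a b
  from′ (inj₁ (inj₁ (e , refl))) = inj₂ (inj₂ (inj₂ (refl , e)))
  from′ (inj₁ (inj₂ (_ , refl))) = inj₁ refl
  from′ (inj₂ (inj₁ (e , refl))) = inj₂ (inj₂ (inj₁ (refl , e)))
  from′ (inj₂ (inj₂ (_ , refl))) = inj₂ (inj₁ refl)

cycAdj-shift : ∀ {m a b a′ b′} → a < m → b < m → CycSucc m a a′ → CycSucc m b b′ →
               CycAdj m a′ b′ ⇔ CycAdj m a b
cycAdj-shift {m} {a} {b} {a′} {b′} a<m b<m sa sb = begin
  CycAdj m a′ b′                      ≈⟨ cycAdj⇔cycSucc (cycSucc-< pos sa) (cycSucc-< pos sb) ⟩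
  (CycSucc m a′ b′ ⊎ CycSucc m b′ a′) ≈⟨ mk⇔ (⊎-map (back sa sb) (back sb sa)) (⊎-map (forth sa sb) (forth sb sa)) ⟩
  (CycSucc m a b ⊎ CycSucc m b a)     ≈⟨ ⇔-sym (cycAdj⇔cycSucc a<m b<m) ⟩
  CycAdj m a b                        ∎
  where
  open ⇔-Reasoning
  pos : 0 < m
  pos = ≤-trans (s≤s z≤n) a<m
  forth : ∀ {a b a′ b′} → CycSucc m a a′ → CycSucc m b b′ → CycSucc m a b → CycSucc m a′ b′
  forth sa sb sab = subst (λ c → CycSucc m c _) (cycSucc-functional sab sa) sb
  back : ∀ {a b a′ b′} → CycSucc m a a′ → CycSucc m b b′ → CycSucc m a′ b′ → CycSucc m a b
  back sa sb s′ = subst (CycSucc m _) (sym (cycSucc-injective sb s′)) sa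

module _ {V : Set} where

  next : (L : List V) (x : V) → Fin (length (L ++ [ x ])) → Fin (suc (length L))
  next []      x zero    = zero
  next (y ∷ L) x zero    = suc zero
  next (y ∷ L) x (suc j) = shift (next L x j)
    where
    shift : ∀ {n} → Fin (suc n) → Fin (suc (suc n))
    shift zero    = zero
    shift (suc k) = suc (suc k)

  lookup-next : ∀ L x j → lookup (L ++ [ x ]) j ≡ lookup (x ∷ L) (next L x j)
  lookup-next []      x zero    = refl
  lookup-next (y ∷ L) x zero    = refl
  lookup-next (y ∷ L) x (suc j) with next L x j | lookup-next L x j
  ... | zero  | e = e
  ... | suc k | e = e

  next-succ : ∀ L x j → CycSucc (suc (length L)) (toℕ j) (toℕ (next L x j))
  next-succ []      x zero    = inj₁ (refl , refl)
  next-succ (y ∷ L) x zero    = inj₂ (s≤s (s≤s z≤n) , refl)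
  next-succ (y ∷ L) x (suc j) with next L x j | next-succ L x j
  ... | zero  | inj₁ (e , _)  = inj₁ (cong suc e , refl)
  ... | suc k | inj₂ (lt , e) = inj₂ (s≤s lt , cong suc e)

module _ {V : Set} (G : Graph V) where

  rotate-one : ∀ x L → InducedCycle G (x ∷ L) → InducedCycle G (L ++ [ x ])
  rotate-one x L (three , dist , adj) = subst (3 ≤_) (sym len) three , dist′ , adj′
    where
    open ⇔-Reasoning
    len : length (L ++ [ x ]) ≡ suc (length L)
    len = length-++-comm L [ x ]
    in-range : ∀ j → toℕ j < suc (length L)
    in-range j = subst (toℕ j <_) len (toℕ<n j)
    dist′ : Distinct G (L ++ [ x ])
    dist′ i j e = toℕ-injective (cycSucc-injective (next-succ L x i)
      (subst (CycSucc _ _) (cong toℕ (sym (dist (next L x i) (next L x j)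
        (trans (sym (lookup-next L x i)) (trans e (lookup-next L x j)))))) (next-succ L x j)))
    adj′ : ∀ i j → Adj G (lookup (L ++ [ x ]) i) (lookup (L ++ [ x ]) j) ⇔
                   CycAdj (length (L ++ [ x ])) (toℕ i) (toℕ j)
    adj′ i j = begin
      Adj G (lookup (L ++ [ x ]) i) (lookup (L ++ [ x ]) j)
        ≡⟨ cong₂ (Adj G) (lookup-next L x i) (lookup-next L x j) ⟩
      Adj G (lookup (x ∷ L) (next L x i)) (lookup (x ∷ L) (next L x j))
        ≈⟨ adj (next L x i) (next L x j) ⟩
      CycAdj (suc (length L)) (toℕ (next L x i)) (toℕ (next L x j))
        ≈⟨ cycAdj-shift (in-range i) (in-range j) (next-succ L x i) (next-succ L x j) ⟩
      CycAdj (suc (length L)) (toℕ i) (toℕ j)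
        ≡⟨ cong (λ m → CycAdj m (toℕ i) (toℕ j)) (sym len) ⟩
      CycAdj (length (L ++ [ x ])) (toℕ i) (toℕ j) ∎

  rotate : ∀ A B → InducedCycle G (A ++ B) → InducedCycle G (B ++ A)
  rotate []      B c = subst (InducedCycle G) (sym (++-identityʳ B)) c
  rotate (a ∷ A) B c =
    subst (InducedCycle G) (++-assoc B [ a ] A)
      (rotate A (B ++ [ a ]) (subst (InducedCycle G) (++-assoc A B [ a ]) (rotate-one a (A ++ B) c)))

-- Closing an induced path through an edge

module _ {V : Set} (G : Graph V) where

  close-by-edge : ∀ {w₁ w₂ S} → 1 ≤ length S → Adj G w₁ w₂ → InducedPath G S →
                  Off G w₁ S → Off G w₂ S →
                  (∀ i → Adj G w₁ (lookup S i) ⇔ suc (toℕ i) ≡ length S) →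
                  (∀ i → Adj G w₂ (lookup S i) ⇔ toℕ i ≡ 0) →
                  InducedCycle G (w₁ ∷ w₂ ∷ S)
  close-by-edge {w₁} {w₂} {S} len e path off₁ off₂ adj₁ adj₂ =
    cycle-close G (s≤s len) (path-cons G path off₂ adj₂ , off₁′ , adj₁′)
    where
    off₁′ : Off G w₁ (w₂ ∷ S)
    off₁′ zero    eq = adj-irrefl G (subst (Adj G w₁) (sym eq) e)
    off₁′ (suc i)    = off₁ i
    adj₁′ : ∀ i → Adj G w₁ (lookup (w₂ ∷ S) i) ⇔ IsEnd (suc (length S)) (toℕ i)
    adj₁′ zero    = mk⇔ (λ _ → inj₁ refl) (λ _ → e)
    adj₁′ (suc i) = ⇔-trans (adj₁ i)
      (mk⇔ (λ f → inj₂ (cong suc f)) (λ { (inj₁ ()) ; (inj₂ f) → suc-injective f }))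

  close-through-edge : ∀ {u₁ u₂ S} → 2 ≤ length S → Adj G u₁ u₂ → InducedPath G S →
                       Off G u₁ S → Off G u₂ S →
                       (∀ i → (Adj G u₁ (lookup S i) ⊎ Adj G u₂ (lookup S i)) ⇔
                              IsEnd (length S) (toℕ i)) →
                       ∃ λ W → InducedCycle G (W ++ S)
  close-through-edge {u₁} {u₂} {S@(s₀ ∷ S₀)} len e path off₁ off₂ attached = cases
    where
    last : Fin (length S)
    last = fromℕ (length S₀)

    sₗ : V
    sₗ = lookup S last

    is-first : ∀ i → toℕ i ≡ 0 → i ≡ zero
    is-first i z = toℕ-injective z

    is-last : ∀ i → suc (toℕ i) ≡ length S → i ≡ last
    is-last i f = toℕ-injective (trans (suc-injective f) (sym (toℕ-fromℕ (length S₀))))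

    Adj-at : V → Fin (length S) → Set
    Adj-at w j = Adj G w (lookup S j)

    attached-first : Adj G u₁ s₀ ⊎ Adj G u₂ s₀
    attached-first = from (attached zero) (inj₁ refl)

    attached-last : Adj G u₁ sₗ ⊎ Adj G u₂ sₗ
    attached-last = from (attached last) (inj₂ (cong suc (toℕ-fromℕ (length S₀))))

    by-vertex : ∀ {w} → Off G w S → (∀ {i} → Adj-at w i → IsEnd (length S) (toℕ i)) →
                Adj G w s₀ → Adj G w sₗ → ∃ λ W → InducedCycle G (W ++ S)
    by-vertex {w} off w-ends a₀ aₗ = [ w ] , cycle-close G len (path , off , λ i → mk⇔ w-ends
      λ { (inj₁ z) → subst (Adj-at w) (sym (is-first i z)) a₀
        ; (inj₂ f) → subst (Adj-at w) (sym (is-last i f)) aₗ })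

    by-edge : ∀ {w₁ w₂} → Adj G w₁ w₂ → Off G w₁ S → Off G w₂ S →
              (∀ {i} → Adj-at w₁ i → IsEnd (length S) (toℕ i)) →
              (∀ {i} → Adj-at w₂ i → IsEnd (length S) (toℕ i)) →
              Adj G w₁ sₗ → ¬ Adj G w₁ s₀ → Adj G w₂ s₀ → ¬ Adj G w₂ sₗ →
              ∃ λ W → InducedCycle G (W ++ S)
    by-edge {w₁} {w₂} e₁₂ off₁′ off₂′ ends₁ ends₂ a₁ₗ ¬a₁₀ a₂₀ ¬a₂ₗ =
      (w₁ ∷ [ w₂ ]) , close-by-edge (≤-trans (s≤s z≤n) len) e₁₂ path off₁′ off₂′
        (λ i → mk⇔ (only-last i) (λ f → subst (Adj-at w₁) (sym (is-last i f)) a₁ₗ))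
        (λ i → mk⇔ (only-first i) (λ z → subst (Adj-at w₂) (sym (is-first i z)) a₂₀))
      where
      only-last : ∀ i → Adj-at w₁ i → suc (toℕ i) ≡ length S
      only-last i a with ends₁ a
      ... | inj₁ z = ⊥-elim (¬a₁₀ (subst (Adj-at w₁) (is-first i z) a))
      ... | inj₂ f = f
      only-first : ∀ i → Adj-at w₂ i → toℕ i ≡ 0
      only-first i a with ends₂ a
      ... | inj₁ z = z
      ... | inj₂ f = ⊥-elim (¬a₂ₗ (subst (Adj-at w₂) (is-last i f) a))

    ends₁ : ∀ {i} → Adj-at u₁ i → IsEnd (length S) (toℕ i)
    ends₁ {i} a = to (attached i) (inj₁ a)

    ends₂ : ∀ {i} → Adj-at u₂ i → IsEnd (length S) (toℕ i)
    ends₂ {i} a = to (attached i) (inj₂ a)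

    cases : ∃ λ W → InducedCycle G (W ++ S)
    cases with adj? G u₁ sₗ | adj? G u₁ s₀
    ... | yes a₁ₗ | yes a₁₀ = by-vertex off₁ ends₁ a₁₀ a₁ₗ
    ... | yes a₁ₗ | no ¬a₁₀ with adj? G u₂ sₗ
    ...   | yes a₂ₗ = by-vertex off₂ ends₂ (resolveʳ attached-first ¬a₁₀) a₂ₗ
    ...   | no ¬a₂ₗ = by-edge e off₁ off₂ ends₁ ends₂ a₁ₗ ¬a₁₀ (resolveʳ attached-first ¬a₁₀) ¬a₂ₗ
    cases | no ¬a₁ₗ | _ with adj? G u₂ s₀
    ...   | yes a₂₀ = by-vertex off₂ ends₂ a₂₀ (resolveʳ attached-last ¬a₁ₗ)
    ...   | no ¬a₂₀ = by-edge (adj-sym G e) off₂ off₁ ends₂ ends₁ (resolveʳ attached-last ¬a₁ₗ) ¬a₂₀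
                        (resolveˡ attached-first ¬a₂₀) ¬a₁ₗ

last-follows : ∀ {V : Set} (p : V) P y → ∃ λ (i : Fin (length (P ++ [ y ]))) →
               lookup (p ∷ P ++ [ y ]) (suc i) ≡ y × lookup (p ∷ P ++ [ y ]) (inject₁ i) ∈ p ∷ P
last-follows p []      y = zero , refl , here refl
last-follows p (q ∷ P) y with last-follows q P y
... | i , is-y , follows = suc i , is-y , there follows

module _ {V : Set} (G : Graph V) where

  extension-start : ∀ {x p P y} → Extension G (p ∷ P) x y → Adj G x p
  extension-start ext = from (proj₂ ext zero (suc zero)) (inj₁ refl)

  extension-end : ∀ {x p P y} → Extension G (p ∷ P) x y → ∃ λ v → v ∈ p ∷ P × Adj G y v
  extension-end {p = p} {P} {y} ext with last-follows p P y
  ... | i , is-y , follows = _ , follows ,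
    subst (λ z → Adj G z (lookup (p ∷ P ++ [ y ]) (inject₁ i))) is-y
      (from (proj₂ ext (suc (suc i)) (suc (inject₁ i))) (inj₂ (cong suc (cong suc (sym (toℕ-inject₁ i))))))

-- Undoing the merge of an edge u₁u₂

module Merging {n : ℕ} (G : Graph (Fin n)) (u₁ u₂ : Fin n) (e : Adj G u₁ u₂) where

  V′ : Set
  V′ = MVertex u₂

  G′ : Graph V′
  G′ = merge G u₁ u₂

  u : V′
  u = mergedVertex G u₁ u₂ e

  vtx-injective : ∀ {a b : V′} → vtx a ≡ vtx b → a ≡ b
  vtx-injective {mv x _} {mv .x _} refl = refl

  vtx≢u₂ : ∀ (a : V′) → vtx a ≢ u₂
  vtx≢u₂ (mv x ne) eq = Irrelevant.⊥-elim (ne eq)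

  Plain : V′ → Set
  Plain a = vtx a ≢ u₁

  plain-adj : ∀ {a b} → Plain a → Plain b → Adj G′ a b ⇔ Adj G (vtx a) (vtx b)
  plain-adj {a} {b} pa pb = mk⇔ to′ from′
    where
    to′ : Adj G′ a b → Adj G (vtx a) (vtx b)
    to′ (_ , inj₁ ad)                = ad
    to′ (_ , inj₂ (inj₁ (eq , _)))   = ⊥-elim (pa eq)
    to′ (_ , inj₂ (inj₂ (eq , _)))   = ⊥-elim (pb eq)
    from′ : Adj G (vtx a) (vtx b) → Adj G′ a b
    from′ ad = (λ eq → adj-irrefl G (subst (Adj G (vtx a)) (sym eq) ad)) , inj₁ ad

  merged-adj : ∀ {a b} → vtx a ≡ u₁ → Plain b → Adj G′ a b ⇔ (Adj G u₁ (vtx b) ⊎ Adj G u₂ (vtx b))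
  merged-adj {a} {b} refl pb = mk⇔ to′ from′
    where
    to′ : Adj G′ a b → Adj G u₁ (vtx b) ⊎ Adj G u₂ (vtx b)
    to′ (_ , inj₁ ad)              = inj₁ ad
    to′ (_ , inj₂ (inj₁ (_ , ad))) = inj₂ ad
    to′ (_ , inj₂ (inj₂ (eq , _))) = ⊥-elim (pb eq)
    from′ : Adj G u₁ (vtx b) ⊎ Adj G u₂ (vtx b) → Adj G′ a b
    from′ (inj₁ ad) = (λ eq → pb (sym eq)) , inj₁ ad
    from′ (inj₂ ad) = (λ eq → pb (sym eq)) , inj₂ (inj₁ (refl , ad))

  map-plain-path : ∀ {L} → All Plain L → InducedPath G′ L ⇔ InducedPath G (map vtx L)
  map-plain-path {L} plain = map-path G′ G vtx L (λ _ _ → vtx-injective)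
    (λ {a} {b} a∈ b∈ → ⇔-sym (plain-adj {a} {b} (All.lookup plain a∈) (All.lookup plain b∈)))

  map-plain-cycle : ∀ {L} → All Plain L → InducedCycle G′ L → InducedCycle G (map vtx L)
  map-plain-cycle {L} plain = map-cycle G′ G vtx L (λ _ _ → vtx-injective)
    (λ {a} {b} a∈ b∈ → ⇔-sym (plain-adj {a} {b} (All.lookup plain a∈) (All.lookup plain b∈)))

  off-map : ∀ {w} {L : List V′} → (∀ {a} → a ∈ L → vtx a ≢ w) → Off G w (map vtx L)
  off-map {w} {L} h i eq with ∈-map⁻ vtx (∈-lookup {xs = map vtx L} i)
  ... | a , a∈ , eq′ = h a∈ (sym (trans eq eq′))

  unmerge-at : ∀ a R → vtx a ≡ u₁ → InducedCycle G′ (a ∷ R) → ∃ λ W → InducedCycle G (W ++ map vtx R)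
  unmerge-at a R va cyc with cycle-open G′ cyc
  ... | len , pathR , offR , a-adj =
    close-through-edge G (subst (2 ≤_) (sym (length-map vtx R)) len) e
      (to (map-plain-path plainR) pathR) (off-map {L = R} (All.lookup plainR)) (off-map {L = R} (λ {b} _ → vtx≢u₂ b)) attached
    where
    open ⇔-Reasoning

    plainR : All Plain R
    plainR = All.tabulate λ {b} b∈R vb →
      offR (index b∈R) (trans (vtx-injective (trans va (sym vb))) (lookup-index b∈R))

    S : List (Fin n)
    S = map vtx R

    attached : ∀ i → (Adj G u₁ (lookup S i) ⊎ Adj G u₂ (lookup S i)) ⇔ IsEnd (length S) (toℕ i)
    attached i = begin
      (Adj G u₁ (lookup S i) ⊎ Adj G u₂ (lookup S i))
        ≡⟨ cong (λ v → Adj G u₁ v ⊎ Adj G u₂ v) (lookup-map vtx R i) ⟩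
      (Adj G u₁ (vtx (lookup R j)) ⊎ Adj G u₂ (vtx (lookup R j)))
        ≈⟨ ⇔-sym (merged-adj {a} {lookup R j} va (All.lookup plainR (∈-lookup j))) ⟩
      Adj G′ a (lookup R j)
        ≈⟨ a-adj j ⟩
      IsEnd (length R) (toℕ j)
        ≡⟨ cong₂ IsEnd (sym (length-map vtx R)) (toℕ-cast _ i) ⟩
      IsEnd (length S) (toℕ i) ∎
      where
      j : Fin (length R)
      j = cast (length-map vtx R) i

  -- induced cycles of G′ through a list of plain vertices give induced
  -- cycles of G through its image: rotate the cycle to start at the
  -- merged vertex (if it occurs), unmerge there, and rotate back
  unmerge-cycle : ∀ E′ → All Plain E′ → ContainedInInducedCycle G′ E′ →
                  ContainedInInducedCycle G (map vtx E′)
  unmerge-cycle E′ plainE (Q , cyc) with any? (λ a → vtx a ≟ u₁) Q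
  ... | no u∉Q = map vtx Q ,
    subst (InducedCycle G) (map-++ vtx E′ Q) (map-plain-cycle (++⁺ plainE (¬Any⇒All¬ Q u∉Q)) cyc)
  ... | yes u∈Q with find u∈Q
  ...   | a , a∈Q , va with ∈-∃++ a∈Q
  ...     | Q₁ , Q₂ , refl with unmerge-at a (Q₂ ++ E′ ++ Q₁) va
                                  (rotate G′ (E′ ++ Q₁) (a ∷ Q₂)
                                    (subst (InducedCycle G′) (sym (++-assoc E′ Q₁ (a ∷ Q₂))) cyc))
  ...       | W , cycW = map vtx Q₁ ++ W ++ map vtx Q₂ ,
    subst (InducedCycle G) regroup (rotate G (W ++ map vtx Q₂) (map vtx (E′ ++ Q₁)) (subst (InducedCycle G) split cycW))
    where
    split : W ++ map vtx (Q₂ ++ E′ ++ Q₁) ≡ (W ++ map vtx Q₂) ++ map vtx (E′ ++ Q₁)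
    split = trans (cong (W ++_) (map-++ vtx Q₂ (E′ ++ Q₁))) (sym (++-assoc W (map vtx Q₂) _))
    regroup : map vtx (E′ ++ Q₁) ++ W ++ map vtx Q₂ ≡ map vtx E′ ++ map vtx Q₁ ++ W ++ map vtx Q₂
    regroup = trans (cong (_++ _) (map-++ vtx E′ Q₁)) (++-assoc (map vtx E′) (map vtx Q₁) _)

  Far : V′ → Set
  Far a = Plain a × ¬ Adj G u₁ (vtx a) × ¬ Adj G u₂ (vtx a)

  far : ∀ {a} → ¬ InClosedNbhd G′ u a → Far a
  far {a} outside = plain , (λ ad → outside (inj₂ (from (merged-adj {u} {a} refl plain) (inj₁ ad))))
                          , (λ ad → outside (inj₂ (from (merged-adj {u} {a} refl plain) (inj₂ ad))))
    where
    plain : Plain a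
    plain eq = outside (inj₁ (vtx-injective eq))

  far-outside : ∀ {a} → Far a → ¬ InClosedNbhd G u₁ (vtx a)
  far-outside (plain , _ , _)  (inj₁ eq) = plain eq
  far-outside (_ , ¬adj₁ , _)  (inj₂ ad) = ¬adj₁ ad

  beside-far : ∀ {w a} → Far a → Adj G w (vtx a) → w ≢ u₁ × w ≢ u₂
  beside-far (_ , ¬adj₁ , ¬adj₂) ad =
    (λ { refl → ¬adj₁ ad }) , (λ { refl → ¬adj₂ ad })

  unmerge-Pk : ∀ {k P′} → PkOutside G′ k u P′ → PkOutside G k u₁ (map vtx P′)
  unmerge-Pk {P′ = P′} (path , len , outside) =
    to (map-plain-path (All.map (λ o → proj₁ (far o)) outside)) path ,
    trans (length-map vtx P′) len ,
    map⁺ {f = vtx} (All.map (λ {a} o → far-outside {a} (far o)) outside)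

  -- an extension xPy in G of the image P of P′ lifts to an extension of P′
  -- in G′, whose containment in an induced cycle of G′ transfers back to G
  unmerge-avoidable : ∀ {k P′} → 1 ≤ k → PkOutside G′ k u P′ → Avoidable G′ P′ → Avoidable G (map vtx P′)
  unmerge-avoidable {P′ = []}      (s≤s _) (_ , () , _) _
  unmerge-avoidable {P′ = p₀ ∷ P₀} _ pk@(_ , _ , outside) (_ , avoid) = proj₁ (unmerge-Pk pk) , no-failing
    where
    P′ : List V′
    P′ = p₀ ∷ P₀

    fars : All Far P′
    fars = All.map far outside

    plains : All Plain P′
    plains = All.map proj₁ fars

    no-failing : ∀ x y → Extension G (map vtx P′) x y → ¬ Failing G (x ∷ (map vtx P′ ++ [ y ]))
    no-failing x y ext (_ , no-cycle) = avoid x′ y′ ext′ (ext′ , λ c →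
      no-cycle (subst (ContainedInInducedCycle G) images (unmerge-cycle E′ plainE c)))
      where
      x-ok : x ≢ u₁ × x ≢ u₂
      x-ok = beside-far {x} {p₀} (All.lookup fars (here refl)) (extension-start G {P = map vtx P₀} ext)

      y-ok : y ≢ u₁ × y ≢ u₂
      y-ok with extension-end G {P = map vtx P₀} ext
      ... | v , v∈ , ad with ∈-map⁻ vtx {xs = P′} v∈
      ...   | b , b∈ , refl = beside-far {y} {b} (All.lookup fars b∈) ad

      x′ y′ : V′
      x′ = mv x (proj₂ x-ok)
      y′ = mv y (proj₂ y-ok)

      E′ : List V′
      E′ = x′ ∷ (P′ ++ [ y′ ])

      images : map vtx E′ ≡ x ∷ (map vtx P′ ++ [ y ])
      images = cong (x ∷_) (map-++ vtx P′ [ y′ ])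

      plainE : All Plain E′
      plainE = proj₁ x-ok ∷ ++⁺ plains (proj₁ y-ok ∷ All.[])

      ext′ : Extension G′ P′ x′ y′
      ext′ = from (map-plain-path plainE) (subst (InducedPath G) (sym images) ext)

lemma2p3 : (k : ℕ) → 1 ≤ k → (n : ℕ) → (G : Graph (Fin n)) → (u₁ u₂ : Fin n) → (e : Adj G u₁ u₂) →
    (∃ λ p → PkOutside (merge G u₁ u₂) k (mergedVertex G u₁ u₂ e) p) →
    HR (merge G u₁ u₂) k (mergedVertex G u₁ u₂ e) →
    HR G k u₁
lemma2p3 k k≥1 n G u₁ u₂ e some-Pk (inj₁ no-Pk)                = ⊥-elim (no-Pk some-Pk)
lemma2p3 k k≥1 n G u₁ u₂ e _       (inj₂ (P′ , pk , avoidable)) =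
  inj₂ (map vtx P′ , unmerge-Pk pk , unmerge-avoidable k≥1 pk avoidable)
  where open Merging G u₁ u₂ e
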